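{- Let $n\ge1$ and $0\le j\le\lfloor 3n/2\rfloor$, and list the tableaux of $\mathrm{SSYT}((3n-j,j),(n,n,n))$ in increasing order of the number of entries $2$ in their second row. Then along this list the $2$-subtypes alternate between $t_{12}$ and $t_{1|2}$. If $j\le n$, the first tableau has $2$-subtype $t_{12}$ and the last has $2$-subtype $t_{12}$ if $j$ is even and $t_{1|2}$ if $j$ is odd. If $j>n$, the first tableau has $2$-subtype $t_{12}$ if $j\equiv n\pmod 2$ and $t_{1|2}$ otherwise, and the last has $2$-subtype $t_{12}$ if $j$ is even and $t_{1|2}$ if $j$ is odd.
   Context: $\mathrm{SSYT}(\mu,(n,n,n))$ is the set of semistandard tableaux of shape $\mu$ in which each of $1,2,3$ occurs $n$ times. The $2$-subtype of such a tableau $T$ is the standard tableau $t_{12}$ (one row $1,2$) if the number of entries $2$ in the second row of $T$ is even, and $t_{1|2}$ (one column $1,2$) if it is odd. -}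

module Defs where

open import Data.Nat using (ℕ; zero; suc; _+_; _≤_; _<_; _%_; _≡ᵇ_)
open import Data.Bool using (if_then_else_)
open import Data.List using (List; []; _∷_; length; _++_; filter)
open import Data.List.Relation.Unary.All using (All)
open import Data.List.Relation.Unary.Linked using (Linked)
open import Data.Product using (_×_)
open import Data.Unit using (⊤)
open import Relation.Binary.PropositionalEquality using (_≡_)
open import Data.Nat.Properties using (_≟_)

occ : ℕ → List ℕ → ℕ
occ v xs = length (filter (_≟ v) xs)

-- A (raw) filling of a two-row Young diagram: first row and second row,
-- each read left to right.
record Tableau : Set where
  constructor tab
  field
    row₁ : List ℕ
    row₂ : List ℕ
open Tableau public

data ColStrict : List ℕ → List ℕ → Set where
  cs-[]  : ∀ {xs} → ColStrict xs []
  cs-∷   : ∀ {x y xs ys} → x < y → ColStrict xs ys → ColStrict (x ∷ xs) (y ∷ ys)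

IsSSYT : ℕ → ℕ → ℕ → Tableau → Set
IsSSYT a b n T =
  length (row₁ T) ≡ a × length (row₂ T) ≡ b ×
  Linked _≤_ (row₁ T) × Linked _≤_ (row₂ T) ×
  ColStrict (row₁ T) (row₂ T) ×
  All (λ x → 1 ≤ x × x ≤ 3) (row₁ T ++ row₂ T) ×
  occ 1 (row₁ T ++ row₂ T) ≡ n ×
  occ 2 (row₁ T ++ row₂ T) ≡ n ×
  occ 3 (row₁ T ++ row₂ T) ≡ n

twos₂ : Tableau → ℕ
twos₂ T = occ 2 (row₂ T)

-- the two standard tableaux of size 2
data SubType : Set where
  t12  : SubType   -- one row 1 2
  t1∣2 : SubType   -- one column 1 / 2

subtype2 : Tableau → SubType
subtype2 T = if (twos₂ T % 2) ≡ᵇ 0 then t12 else t1∣2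

{-# OPTIONS --safe #-}
module Submission where

-- Column strictness keeps the entries 1 out of the second row, so a tableau T of shape
-- (3n − j, j) and content (n, n, n) has rows 1ⁿ 2ⁿ⁻ᵏ 3ⁿ⁻⁽ʲ⁻ᵏ⁾ and 2ᵏ 3ʲ⁻ᵏ, where k is the
-- number of 2s in its second row.  Hence T is determined by k, and such a T exists exactly
-- when max(0, j − n) ≤ k ≤ min(j, 2n − j).  Listing the tableaux by increasing k therefore
-- runs through this interval in steps of one; the 2-subtype is the parity of k, so it
-- alternates, and the subtypes at the ends are the parities of the endpoints, 0 and j when
-- j ≤ n, and j − n and 2n − j when j > n.

open import Defs
open import Data.Nat using (ℕ; zero; suc; _+_; _*_; _∸_; _≤_; _<_; _/_; _%_; _≡ᵇ_; z≤n; s≤s)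
open import Data.Nat.Properties
open import Data.Nat.DivMod using (m/n*n≤m)
open import Data.Nat.Solver using (module +-*-Solver)
open import Algebra.Properties.CommutativeSemigroup +-commutativeSemigroup using (x∙yz≈y∙xz)
open import Data.Bool using (if_then_else_)
open import Data.List using (List; []; _∷_; _++_; length; filter; replicate; map; head; last)
open import Data.List.Properties
  using (filter-++; filter-none; length-++; length-replicate; ++-identityʳ; map-∘; head-map; last-map)
open import Data.List.Relation.Unary.All using (All; []; _∷_)
import Data.List.Relation.Unary.All as All
import Data.List.Relation.Unary.All.Properties as All
open import Data.List.Relation.Unary.AllPairs using ([]; _∷_)
open import Data.List.Relation.Unary.Any using (here; there)
open import Data.List.Membership.Propositional using (_∈_)
open import Data.List.Membership.Propositional.Properties using (∈-map⁺; ∈-map⁻)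
open import Data.List.Relation.Unary.Unique.Propositional using (Unique)
open import Data.List.Relation.Unary.Linked using (Linked; []; [-]; _∷_)
import Data.List.Relation.Unary.Linked as Linked
open import Data.List.Relation.Unary.Linked.Properties using (Linked⇒All; map⁻)
import Data.Maybe as Maybe
open import Data.Maybe using (just)
open import Data.Maybe.Properties using (just-injective)
open import Data.Product using (_×_; _,_; proj₁; proj₂; uncurry)
open import Data.Empty using (⊥-elim)
open import Function.Base using (_∘_)
open import Function.Bundles using (_⇔_; mk⇔; Equivalence)
open import Relation.Nullary using (yes; no)
open import Relation.Binary.PropositionalEquality

open Equivalence using (to; from)

Linked-∷⇒All : ∀ {A : Set} {R : A → A → Set} → (∀ {x y z} → R x y → R y z → R x z) →
               ∀ {x xs} → Linked R (x ∷ xs) → All (R x) xs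
Linked-∷⇒All _     [-]         = []
Linked-∷⇒All trans (Rxy ∷ Rys) = Linked⇒All trans Rxy Rys

occ-++ : ∀ v xs ys → occ v (xs ++ ys) ≡ occ v xs + occ v ys
occ-++ v xs ys = trans (cong length (filter-++ (_≟ v) xs ys)) (length-++ (filter (_≟ v) xs))

occ-++-≡ : ∀ v xs ys {a b} → occ v xs ≡ a → occ v ys ≡ b → occ v (xs ++ ys) ≡ a + b
occ-++-≡ v xs ys refl refl = occ-++ v xs ys

occ-none : ∀ {v xs} → All (v <_) xs → occ v xs ≡ 0
occ-none v<xs = cong length (filter-none (_≟ _) (All.map (λ v<x x≡v → <-irrefl (sym x≡v) v<x) v<xs))

blocks : ℕ → ℕ → ℕ → List ℕ
blocks a b c = replicate a 1 ++ replicate b 2 ++ replicate c 3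

length-blocks : ∀ a b c → length (blocks a b c) ≡ a + (b + c)
length-blocks a b c =
  trans (length-++ (replicate a 1))
    (cong₂ _+_ (length-replicate a)
      (trans (length-++ (replicate b 2)) (cong₂ _+_ (length-replicate b) (length-replicate c))))

occ₁-blocks : ∀ a b c → occ 1 (blocks a b c) ≡ a
occ₁-blocks (suc a) b       c       = cong suc (occ₁-blocks a b c)
occ₁-blocks zero    (suc b) c       = occ₁-blocks zero b c
occ₁-blocks zero    zero    (suc c) = occ₁-blocks zero zero c
occ₁-blocks zero    zero    zero    = refl

occ₂-blocks : ∀ a b c → occ 2 (blocks a b c) ≡ b
occ₂-blocks (suc a) b       c       = occ₂-blocks a b c
occ₂-blocks zero    (suc b) c       = cong suc (occ₂-blocks zero b c)
occ₂-blocks zero    zero    (suc c) = occ₂-blocks zero zero c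
occ₂-blocks zero    zero    zero    = refl

occ₃-blocks : ∀ a b c → occ 3 (blocks a b c) ≡ c
occ₃-blocks (suc a) b       c       = occ₃-blocks a b c
occ₃-blocks zero    (suc b) c       = occ₃-blocks zero b c
occ₃-blocks zero    zero    (suc c) = cong suc (occ₃-blocks zero zero c)
occ₃-blocks zero    zero    zero    = refl

InRange : ℕ → Set
InRange x = 1 ≤ x × x ≤ 3

blocks-inRange : ∀ a b c → All InRange (blocks a b c)
blocks-inRange a b c =
  All.++⁺ (All.replicate⁺ a (≤-refl , s≤s z≤n))
    (All.++⁺ (All.replicate⁺ b (s≤s z≤n , s≤s (s≤s z≤n))) (All.replicate⁺ c (s≤s z≤n , ≤-refl)))

replicate-++-sorted : ∀ a {x ys} → All (x ≤_) ys → Linked _≤_ ys → Linked _≤_ (replicate a x ++ ys)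
replicate-++-sorted zero          _          ys↗ = ys↗
replicate-++-sorted (suc zero)    []         ys↗ = [-]
replicate-++-sorted (suc zero)    (x≤y ∷ _)  ys↗ = x≤y ∷ ys↗
replicate-++-sorted (suc (suc a)) x≤ys       ys↗ = ≤-refl ∷ replicate-++-sorted (suc a) x≤ys ys↗

blocks-sorted : ∀ a b c → Linked _≤_ (blocks a b c)
blocks-sorted a b c =
  replicate-++-sorted a (All.map proj₁ (All.++⁻ʳ (replicate a 1) (blocks-inRange a b c)))
    (replicate-++-sorted b (All.replicate⁺ c (s≤s (s≤s z≤n)))
      (subst (Linked _≤_) (++-identityʳ (replicate c 3)) (replicate-++-sorted c [] [])))

2∷blocks : ∀ {ys a b c} → a ≡ 0 → ys ≡ blocks a b c → 2 ∷ ys ≡ blocks a (suc b) c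
2∷blocks refl refl = refl

3∷blocks : ∀ {ys a b c} → a ≡ 0 → b ≡ 0 → ys ≡ blocks a b c → 3 ∷ ys ≡ blocks a b (suc c)
3∷blocks refl refl refl = refl

sorted⇒blocks : ∀ {xs} → Linked _≤_ xs → All InRange xs → xs ≡ blocks (occ 1 xs) (occ 2 xs) (occ 3 xs)
sorted⇒blocks {[]}     _   _         = refl
sorted⇒blocks {1 ∷ ys} ys↗ (_ ∷ ys∈) = cong (1 ∷_) (sorted⇒blocks (Linked.tail ys↗) ys∈)
sorted⇒blocks {2 ∷ ys} ys↗ (_ ∷ ys∈) =
  2∷blocks {b = occ 2 ys} {occ 3 ys} (occ-none (Linked-∷⇒All ≤-trans ys↗))
    (sorted⇒blocks (Linked.tail ys↗) ys∈)
sorted⇒blocks {3 ∷ ys} ys↗ (_ ∷ ys∈) =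
  3∷blocks {c = occ 3 ys} (occ-none (All.map (≤-trans (s≤s (s≤s z≤n))) 3≤ys)) (occ-none 3≤ys)
    (sorted⇒blocks (Linked.tail ys↗) ys∈)
  where
  3≤ys : All (3 ≤_) ys
  3≤ys = Linked-∷⇒All ≤-trans ys↗
sorted⇒blocks {suc (suc (suc (suc _))) ∷ _} _ ((_ , s≤s (s≤s (s≤s ()))) ∷ _)

colStrict-above : ∀ {v xs ys} → ColStrict xs ys → All (v ≤_) xs → All (v <_) ys
colStrict-above cs-[]          _            = []
colStrict-above (cs-∷ x<y x⇉y) (v≤x ∷ v≤xs) = ≤-<-trans v≤x x<y ∷ colStrict-above x⇉y v≤xs

colStrict-blocks⇒length≤ : ∀ a b c {ys} → ColStrict (blocks a b c) ys → All (_≤ 3) ys → length ys ≤ a + b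
colStrict-blocks⇒length≤ _       _       _       {[]} _           _          = z≤n
colStrict-blocks⇒length≤ (suc a) b       c       (cs-∷ _ cs)   (_ ∷ ys≤3) = s≤s (colStrict-blocks⇒length≤ a b c cs ys≤3)
colStrict-blocks⇒length≤ zero    (suc b) c       (cs-∷ _ cs)   (_ ∷ ys≤3) = s≤s (colStrict-blocks⇒length≤ 0 b c cs ys≤3)
colStrict-blocks⇒length≤ zero    zero    (suc c) (cs-∷ 3<y _)  (y≤3 ∷ _)  = ⊥-elim (<⇒≱ 3<y y≤3)

blocks-colStrict-3s : ∀ a b c {m} → m ≤ a + b → ColStrict (blocks a b c) (replicate m 3)
blocks-colStrict-3s _       _       _ {zero}  _        = cs-[]
blocks-colStrict-3s (suc a) b       c {suc m} (s≤s m≤) = cs-∷ (s≤s (s≤s z≤n)) (blocks-colStrict-3s a b c m≤)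
blocks-colStrict-3s zero    (suc b) c {suc m} (s≤s m≤) = cs-∷ ≤-refl (blocks-colStrict-3s 0 b c m≤)

blocks-colStrict : ∀ a b c {k m} → k ≤ a → k + m ≤ a + b → ColStrict (blocks a b c) (blocks 0 k m)
blocks-colStrict a       b c {zero}  _         m≤    = blocks-colStrict-3s a b c m≤
blocks-colStrict (suc a) b c {suc k} (s≤s k≤a) (s≤s m≤) = cs-∷ (s≤s (s≤s z≤n)) (blocks-colStrict a b c k≤a m≤)

canonical : ℕ → ℕ → ℕ → Tableau
canonical n j k = tab (blocks n (n ∸ k) (n ∸ (j ∸ k))) (blocks 0 k (j ∸ k))

-- The first three conditions make the exponents n ∸ k, j ∸ k and n ∸ (j ∸ k) of canonical n j k
-- honest (no truncated subtraction); the last says that its second row fits above the 1s and 2s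
-- of its first row.
Admissible : ℕ → ℕ → ℕ → Set
Admissible n j k = k ≤ n × k ≤ j × j ≤ n + k × k + j ≤ n + n

twos₂-canonical : ∀ n j k → twos₂ (canonical n j k) ≡ k
twos₂-canonical n j k = occ₂-blocks 0 k (j ∸ k)

canonical-isSSYT : ∀ {n j k} → Admissible n j k → IsSSYT (3 * n ∸ j) j n (canonical n j k)
canonical-isSSYT {n} {j} {k} (k≤n , k≤j , j≤n+k , k+j≤n+n) =
  length₁ , trans (length-blocks 0 k c) k+c≡j ,
  blocks-sorted n p q , blocks-sorted 0 k c ,
  blocks-colStrict n p q k≤n (+-cancelˡ-≤ k _ _ fits) ,
  All.++⁺ (blocks-inRange n p q) (blocks-inRange 0 k c) ,
  trans (occ-++-≡ 1 r₁ r₂ (occ₁-blocks n p q) (occ₁-blocks 0 k c)) (+-identityʳ n) ,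
  trans (occ-++-≡ 2 r₁ r₂ (occ₂-blocks n p q) (occ₂-blocks 0 k c)) (trans (+-comm p k) k+p≡n) ,
  trans (occ-++-≡ 3 r₁ r₂ (occ₃-blocks n p q) (occ₃-blocks 0 k c)) (trans (+-comm q c) c+q≡n)
  where
  p c q : ℕ
  p = n ∸ k
  c = j ∸ k
  q = n ∸ c
  r₁ r₂ : List ℕ
  r₁ = blocks n p q
  r₂ = blocks 0 k c
  k+p≡n : k + p ≡ n
  k+p≡n = m+[n∸m]≡n k≤n
  k+c≡j : k + c ≡ j
  k+c≡j = m+[n∸m]≡n k≤j
  c+q≡n : c + q ≡ n
  c+q≡n = m+[n∸m]≡n (m≤n+o⇒m∸n≤o j k (subst (j ≤_) (+-comm n k) j≤n+k))
  length₁ : length (blocks n p q) ≡ 3 * n ∸ j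
  length₁ = begin
    length (blocks n p q)       ≡⟨ length-blocks n p q ⟩
    n + (p + q)                 ≡⟨ m+n∸n≡m (n + (p + q)) j ⟨
    n + (p + q) + j ∸ j         ≡⟨ cong (λ m → n + (p + q) + m ∸ j) k+c≡j ⟨
    n + (p + q) + (k + c) ∸ j   ≡⟨ cong (_∸ j) (regroup n p q k c) ⟩
    n + ((k + p) + (c + q)) ∸ j ≡⟨ cong₂ (λ x y → n + (x + y) ∸ j) k+p≡n c+q≡n ⟩
    n + (n + n) ∸ j             ≡⟨ cong (λ m → n + (n + m) ∸ j) (+-identityʳ n) ⟨
    3 * n ∸ j                   ∎
    where
    open ≡-Reasoning
    open +-*-Solver
    regroup : ∀ n p q k c → n + (p + q) + (k + c) ≡ n + ((k + p) + (c + q))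
    regroup = solve 5 (λ n p q k c → n :+ (p :+ q) :+ (k :+ c) := n :+ ((k :+ p) :+ (c :+ q))) refl
  fits : k + (k + c) ≤ k + (n + p)
  fits = begin
    k + (k + c) ≡⟨ cong (k +_) k+c≡j ⟩
    k + j       ≤⟨ k+j≤n+n ⟩
    n + n       ≡⟨ cong (n +_) k+p≡n ⟨
    n + (k + p) ≡⟨ x∙yz≈y∙xz n k p ⟩
    k + (n + p) ∎
    where open ≤-Reasoning

m+n≡o⇒n≡o∸m : ∀ {m n o} → m + n ≡ o → n ≡ o ∸ m
m+n≡o⇒n≡o∸m {m} {n} refl = sym (m+n∸m≡n m n)

counts⇒admissible : ∀ {n j y z k c} → y + k ≡ n → z + c ≡ n → k + c ≡ j → j ≤ n + y → Admissible n j k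
counts⇒admissible {n} {j} {y} {z} {k} {c} y+k≡n z+c≡n k+c≡j j≤n+y =
  subst (k ≤_) y+k≡n (m≤n+m k y) ,
  subst (k ≤_) k+c≡j (m≤m+n k c) ,
  (begin
    j     ≡⟨ k+c≡j ⟨
    k + c ≤⟨ +-monoʳ-≤ k (subst (c ≤_) z+c≡n (m≤n+m c z)) ⟩
    k + n ≡⟨ +-comm k n ⟩
    n + k ∎) ,
  (begin
    k + j       ≤⟨ +-monoʳ-≤ k j≤n+y ⟩
    k + (n + y) ≡⟨ x∙yz≈y∙xz k n y ⟩
    n + (k + y) ≡⟨ cong (n +_) (trans (+-comm k y) y+k≡n) ⟩
    n + n       ∎)
  where open ≤-Reasoning

counts⇒canonical : ∀ {n j y z k c} → y + k ≡ n → z + c ≡ n → k + c ≡ j →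
                   tab (blocks n y z) (blocks 0 k c) ≡ canonical n j k
counts⇒canonical {n} {j} {y} {z} {k} {c} y+k≡n z+c≡n k+c≡j =
  cong₂ tab (cong₂ (blocks n) (m+n≡o⇒n≡o∸m {k} (trans (+-comm k y) y+k≡n))
                              (trans (m+n≡o⇒n≡o∸m {c} (trans (+-comm c z) z+c≡n)) (cong (n ∸_) c≡j∸k)))
            (cong (blocks 0 k) c≡j∸k)
  where
  c≡j∸k : c ≡ j ∸ k
  c≡j∸k = m+n≡o⇒n≡o∸m k+c≡j

isSSYT-classification : ∀ {a j n} T → IsSSYT a j n T →
                        Admissible n j (twos₂ T) × T ≡ canonical n j (twos₂ T)
isSSYT-classification {a} {j} {n} (tab r₁ r₂) (_ , len₂ , r₁↗ , r₂↗ , r₁⇉r₂ , r∈ , occ₁≡n , occ₂≡n , occ₃≡n) =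
  counts⇒admissible y+k≡n z+c≡n k+c≡j j≤n+y ,
  trans (cong₂ tab r₁≡ r₂≡) (counts⇒canonical {y = y} {z} {k} {c} y+k≡n z+c≡n k+c≡j)
  where
  y z k c : ℕ
  y = occ 2 r₁
  z = occ 3 r₁
  k = occ 2 r₂
  c = occ 3 r₂
  r₁∈ : All InRange r₁
  r₁∈ = All.++⁻ˡ r₁ r∈
  r₂∈ : All InRange r₂
  r₂∈ = All.++⁻ʳ r₁ r∈
  split : ∀ {v} → occ v (r₁ ++ r₂) ≡ n → occ v r₁ + occ v r₂ ≡ n
  split {v} = trans (sym (occ-++ v r₁ r₂))
  no-1s : occ 1 r₂ ≡ 0
  no-1s = occ-none (colStrict-above r₁⇉r₂ (All.map proj₁ r₁∈))
  x≡n : occ 1 r₁ ≡ n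
  x≡n = trans (sym (+-identityʳ _)) (subst (λ o → occ 1 r₁ + o ≡ n) no-1s (split occ₁≡n))
  y+k≡n : y + k ≡ n
  y+k≡n = split occ₂≡n
  z+c≡n : z + c ≡ n
  z+c≡n = split occ₃≡n
  r₁≡ : r₁ ≡ blocks n y z
  r₁≡ = trans (sorted⇒blocks r₁↗ r₁∈) (cong (λ x → blocks x y z) x≡n)
  r₂≡ : r₂ ≡ blocks 0 k c
  r₂≡ = trans (sorted⇒blocks r₂↗ r₂∈) (cong (λ x → blocks x k c) no-1s)
  k+c≡j : k + c ≡ j
  k+c≡j = trans (sym (length-blocks 0 k c)) (trans (cong length (sym r₂≡)) len₂)
  j≤n+y : j ≤ n + y
  j≤n+y = subst (_≤ n + y) len₂
    (colStrict-blocks⇒length≤ n y z (subst (λ r → ColStrict r r₂) r₁≡ r₁⇉r₂) (All.map proj₂ r₂∈))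

isSSYT-twos₂-injective : ∀ {a j n S T} → IsSSYT a j n S → IsSSYT a j n T → twos₂ S ≡ twos₂ T → S ≡ T
isSSYT-twos₂-injective {j = j} {n} {S} {T} S-ssyt T-ssyt e =
  trans (proj₂ (isSSYT-classification S S-ssyt))
    (trans (cong (canonical n j) e) (sym (proj₂ (isSSYT-classification T T-ssyt))))

map-strictlyIncreasing : ∀ {A : Set} (f : A → ℕ) {xs} →
                         (∀ {x y} → x ∈ xs → y ∈ xs → f x ≡ f y → x ≡ y) → Unique xs →
                         Linked (λ x y → f x ≤ f y) xs → Linked _<_ (map f xs)
map-strictlyIncreasing f _   _                  []            = []
map-strictlyIncreasing f _   _                  [-]           = [-]
map-strictlyIncreasing f inj ((x≢y ∷ _) ∷ uniq) (fx≤fy ∷ ys↗) =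
  ≤∧≢⇒< fx≤fy (x≢y ∘ inj (here refl) (there (here refl))) ∷
  map-strictlyIncreasing f (λ x∈ y∈ → inj (there x∈) (there y∈)) uniq ys↗

head-<-tail : ∀ {x xs k} → Linked _<_ (x ∷ xs) → k ∈ xs → x < k
head-<-tail xs↗ = All.lookup (Linked-∷⇒All <-trans xs↗)

head-≡-lowerBound : ∀ {x xs lo} → Linked _<_ (x ∷ xs) → lo ≤ x → lo ∈ x ∷ xs → x ≡ lo
head-≡-lowerBound _   _    (here refl) = refl
head-≡-lowerBound xs↗ lo≤x (there lo∈) = ⊥-elim (<⇒≱ (head-<-tail xs↗ lo∈) lo≤x)

tail-interval : ∀ {x xs hi} → Linked _<_ (x ∷ xs) → (∀ {k} → k ∈ x ∷ xs ⇔ (x ≤ k × k ≤ hi)) →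
                ∀ {k} → k ∈ xs ⇔ (suc x ≤ k × k ≤ hi)
tail-interval {x} {xs} {hi} xs↗ mem = mk⇔ (λ k∈ → head-<-tail xs↗ k∈ , proj₂ (to mem (there k∈))) above-x
  where
  above-x : ∀ {k} → x < k × k ≤ hi → k ∈ xs
  above-x (x<k , k≤hi) with from mem (<⇒≤ x<k , k≤hi)
  ... | here refl = ⊥-elim (<-irrefl refl x<k)
  ... | there k∈  = k∈

interval-enumeration : ∀ {lo hi} xs → lo ≤ hi → Linked _<_ xs → (∀ {k} → k ∈ xs ⇔ (lo ≤ k × k ≤ hi)) →
                       head xs ≡ just lo × last xs ≡ just hi × Linked (λ x y → y ≡ suc x) xs
interval-enumeration [] lo≤hi _ mem with from mem (≤-refl , lo≤hi)
... | ()
interval-enumeration (x ∷ xs) lo≤hi xs↗ mem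
  with head-≡-lowerBound xs↗ (proj₁ (to mem (here refl))) (from mem (≤-refl , lo≤hi))
interval-enumeration (x ∷ []) lo≤hi _ mem | refl with from mem (lo≤hi , ≤-refl)
... | here refl = refl , refl , [-]
interval-enumeration {hi = hi} (x ∷ y ∷ ys) lo≤hi xs↗ mem | refl
  with interval-enumeration (y ∷ ys) (uncurry ≤-trans (to tail-mem (here refl))) (Linked.tail xs↗) tail-mem
  where
  tail-mem : ∀ {k} → k ∈ y ∷ ys ⇔ (suc x ≤ k × k ≤ hi)
  tail-mem = tail-interval xs↗ mem
... | first , final , steps = refl , final , just-injective first ∷ steps

parityType : ℕ → SubType
parityType k = if k % 2 ≡ᵇ 0 then t12 else t1∣2

%2-≡⇒parityType-≡ : ∀ m n → m % 2 ≡ n % 2 → parityType m ≡ parityType n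
%2-≡⇒parityType-≡ _ _ e rewrite e = refl

parityType-≡⇒%2-≡ : ∀ m n → parityType m ≡ parityType n → m % 2 ≡ n % 2
parityType-≡⇒%2-≡ (suc (suc m)) n             e = parityType-≡⇒%2-≡ m n e
parityType-≡⇒%2-≡ 0             (suc (suc n)) e = parityType-≡⇒%2-≡ 0 n e
parityType-≡⇒%2-≡ 1             (suc (suc n)) e = parityType-≡⇒%2-≡ 1 n e
parityType-≡⇒%2-≡ 0             0             _ = refl
parityType-≡⇒%2-≡ 1             1             _ = refl

parityType-suc-≢ : ∀ k → parityType (suc k) ≢ parityType k
parityType-suc-≢ 0             ()
parityType-suc-≢ 1             ()
parityType-suc-≢ (suc (suc k)) = parityType-suc-≢ k

infixl 6 _⊕_
_⊕_ : SubType → SubType → SubType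
t12  ⊕ s    = s
t1∣2 ⊕ t12  = t1∣2
t1∣2 ⊕ t1∣2 = t12

s⊕u⊕u≡s : ∀ s u → s ⊕ u ⊕ u ≡ s
s⊕u⊕u≡s t12  t12  = refl
s⊕u⊕u≡s t12  t1∣2 = refl
s⊕u⊕u≡s t1∣2 t12  = refl
s⊕u⊕u≡s t1∣2 t1∣2 = refl

s⊕u≡s⇒u≡t12 : ∀ s u → s ⊕ u ≡ s → u ≡ t12
s⊕u≡s⇒u≡t12 t12  t12 _ = refl
s⊕u≡s⇒u≡t12 t1∣2 t12 _ = refl

s⊕u≢s⇒u≡t1∣2 : ∀ s u → s ⊕ u ≢ s → u ≡ t1∣2
s⊕u≢s⇒u≡t1∣2 t12  t12  ne = ⊥-elim (ne refl)
s⊕u≢s⇒u≡t1∣2 t12  t1∣2 _  = refl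
s⊕u≢s⇒u≡t1∣2 t1∣2 t12  ne = ⊥-elim (ne refl)
s⊕u≢s⇒u≡t1∣2 t1∣2 t1∣2 _  = refl

parityType-suc : ∀ n → parityType (suc n) ≡ t1∣2 ⊕ parityType n
parityType-suc 0             = refl
parityType-suc 1             = refl
parityType-suc (suc (suc n)) = parityType-suc n

parityType-+ : ∀ m n → parityType (m + n) ≡ parityType m ⊕ parityType n
parityType-+ 0             n = refl
parityType-+ 1             n = parityType-suc n
parityType-+ (suc (suc m)) n = parityType-+ m n

parityType-∸ : ∀ {n d} → d ≤ n → parityType (n ∸ d) ≡ parityType (n + d)
parityType-∸ {n} {d} d≤n = begin
  parityType (n ∸ d)                               ≡⟨ s⊕u⊕u≡s _ (parityType d) ⟨
  parityType (n ∸ d) ⊕ parityType d ⊕ parityType d ≡⟨ cong (_⊕ parityType d) (parityType-+ (n ∸ d) d) ⟨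
  parityType (n ∸ d + d) ⊕ parityType d            ≡⟨ cong (λ m → parityType m ⊕ parityType d) (m∸n+n≡m d≤n) ⟩
  parityType n ⊕ parityType d                      ≡⟨ parityType-+ n d ⟨
  parityType (n + d)                               ∎
  where open ≡-Reasoning

%2-+-same⇒parityType≡t12 : ∀ n d → (n + d) % 2 ≡ n % 2 → parityType d ≡ t12
%2-+-same⇒parityType≡t12 n d e =
  s⊕u≡s⇒u≡t12 _ _ (trans (sym (parityType-+ n d)) (%2-≡⇒parityType-≡ (n + d) n e))

%2-+-differs⇒parityType≡t1∣2 : ∀ n d → (n + d) % 2 ≢ n % 2 → parityType d ≡ t1∣2
%2-+-differs⇒parityType≡t1∣2 n d ne =
  s⊕u≢s⇒u≡t1∣2 _ _ (ne ∘ parityType-≡⇒%2-≡ (n + d) n ∘ trans (parityType-+ n d))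

sorted-enumeration-subtype2 : ∀ {n j lo hi} (L : List Tableau) →
  (∀ T → IsSSYT (3 * n ∸ j) j n T ⇔ T ∈ L) → Unique L → Linked (λ S T → twos₂ S ≤ twos₂ T) L →
  (∀ {k} → Admissible n j k ⇔ (lo ≤ k × k ≤ hi)) → lo ≤ hi →
  Linked (λ S T → subtype2 S ≢ subtype2 T) L ×
  head (map subtype2 L) ≡ just (parityType lo) × last (map subtype2 L) ≡ just (parityType hi)
sorted-enumeration-subtype2 {n} {j} {lo} {hi} L L-enumerates uniq sorted interval lo≤hi
  with interval-enumeration (map twos₂ L) lo≤hi
         (map-strictlyIncreasing twos₂ (λ S∈ T∈ → isSSYT-twos₂-injective (isSSYT S∈) (isSSYT T∈)) uniq sorted)
         twos₂-interval
  where
  isSSYT : ∀ {T} → T ∈ L → IsSSYT (3 * n ∸ j) j n T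
  isSSYT {T} = from (L-enumerates T)
  twos₂-interval : ∀ {k} → k ∈ map twos₂ L ⇔ (lo ≤ k × k ≤ hi)
  twos₂-interval {k} = mk⇔
    (λ k∈ → let (T , T∈ , k≡) = ∈-map⁻ twos₂ k∈ in
      to interval (subst (Admissible n j) (sym k≡) (proj₁ (isSSYT-classification T (isSSYT T∈)))))
    (λ k∈ → subst (_∈ map twos₂ L) (twos₂-canonical n j k)
      (∈-map⁺ twos₂ (to (L-enumerates _) (canonical-isSSYT (from interval k∈)))))
... | first , final , steps =
  Linked.map (λ {S} step e → parityType-suc-≢ (twos₂ S) (trans (cong parityType (sym step)) (sym e))) (map⁻ steps) ,
  trans (cong head (map-∘ L)) (trans (head-map (map twos₂ L)) (cong (Maybe.map parityType) first)) ,
  trans (cong last (map-∘ L)) (trans (last-map parityType (map twos₂ L)) (cong (Maybe.map parityType) final))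

admissible-j≤n : ∀ {n j k} → j ≤ n → Admissible n j k ⇔ (0 ≤ k × k ≤ j)
admissible-j≤n {n} {j} {k} j≤n = mk⇔
  (λ (_ , k≤j , _) → z≤n , k≤j)
  (λ (_ , k≤j) → ≤-trans k≤j j≤n , k≤j , ≤-trans j≤n (m≤m+n n k) , +-mono-≤ (≤-trans k≤j j≤n) j≤n)

admissible-n≤j : ∀ {n d k} → d + d ≤ n → Admissible n (n + d) k ⇔ (d ≤ k × k ≤ n ∸ d)
admissible-n≤j {n} {d} {k} d+d≤n = mk⇔ to-interval from-interval
  where
  shift : k + (n + d) ≡ n + (k + d)
  shift = x∙yz≈y∙xz k n d
  to-interval : Admissible n (n + d) k → d ≤ k × k ≤ n ∸ d
  to-interval (_ , _ , n+d≤n+k , k+j≤n+n) =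
    +-cancelˡ-≤ n d k n+d≤n+k ,
    m+n≤o⇒m≤o∸n k (+-cancelˡ-≤ n _ _ (subst (_≤ n + n) shift k+j≤n+n))
  from-interval : d ≤ k × k ≤ n ∸ d → Admissible n (n + d) k
  from-interval (d≤k , k≤n∸d) =
    k≤n , ≤-trans k≤n (m≤m+n n d) , +-monoʳ-≤ n d≤k , subst (_≤ n + n) (sym shift) (+-monoʳ-≤ n k+d≤n)
    where
    k+d≤n : k + d ≤ n
    k+d≤n = m≤o∸n⇒m+n≤o k (m+n≤o⇒m≤o d d+d≤n) k≤n∸d
    k≤n : k ≤ n
    k≤n = m+n≤o⇒m≤o k k+d≤n

m≤n/2⇒m+m≤n : ∀ m n → m ≤ n / 2 → m + m ≤ n
m≤n/2⇒m+m≤n m n m≤n/2 = begin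
  m + m     ≡⟨ cong (m +_) (+-identityʳ m) ⟨
  2 * m     ≡⟨ *-comm 2 m ⟩
  m * 2     ≤⟨ *-monoˡ-≤ 2 m≤n/2 ⟩
  n / 2 * 2 ≤⟨ m/n*n≤m n 2 ⟩
  n         ∎
  where open ≤-Reasoning

n+d≤3n/2⇒d+d≤n : ∀ n d → n + d ≤ (3 * n) / 2 → d + d ≤ n
n+d≤3n/2⇒d+d≤n n d n+d≤3n/2 = +-cancelˡ-≤ (n + n) _ _ (begin
  n + n + (d + d) ≡⟨ regroup n d ⟩
  n + d + (n + d) ≤⟨ m≤n/2⇒m+m≤n (n + d) (3 * n) n+d≤3n/2 ⟩
  3 * n           ≡⟨ triple n ⟩
  n + n + n       ∎)
  where
  open ≤-Reasoning
  open +-*-Solver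
  regroup : ∀ n d → n + n + (d + d) ≡ n + d + (n + d)
  regroup = solve 2 (λ n d → n :+ n :+ (d :+ d) := n :+ d :+ (n :+ d)) refl
  triple : ∀ n → 3 * n ≡ n + n + n
  triple = solve 1 (λ n → con 3 :* n := n :+ n :+ n) refl

mainTheorem5 : (n j : ℕ) → 1 ≤ n → j ≤ (3 * n) / 2 →
    (L : List Tableau) →
    (∀ T → IsSSYT (3 * n ∸ j) j n T ⇔ T ∈ L) → Unique L →
    Linked (λ S T → twos₂ S ≤ twos₂ T) L →
    Linked (λ S T → subtype2 S ≢ subtype2 T) L ×
    (j ≤ n →
      head (map subtype2 L) ≡ just t12 ×
      (j % 2 ≡ 0 → last (map subtype2 L) ≡ just t12) ×
      (j % 2 ≡ 1 → last (map subtype2 L) ≡ just t1∣2)) ×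
    (n < j →
      (j % 2 ≡ n % 2 → head (map subtype2 L) ≡ just t12) ×
      (j % 2 ≢ n % 2 → head (map subtype2 L) ≡ just t1∣2) ×
      (j % 2 ≡ 0 → last (map subtype2 L) ≡ just t12) ×
      (j % 2 ≡ 1 → last (map subtype2 L) ≡ just t1∣2))
mainTheorem5 n j _ j≤3n/2 L L-enumerates uniq sorted with j ≤? n
... | yes j≤n with sorted-enumeration-subtype2 L L-enumerates uniq sorted (admissible-j≤n j≤n) z≤n
...   | alternating , first , final =
  alternating ,
  (λ _ → first , (λ e → trans final (cong just (%2-≡⇒parityType-≡ j 0 e)))
               , (λ e → trans final (cong just (%2-≡⇒parityType-≡ j 1 e)))) ,
  (λ n<j → ⊥-elim (<⇒≱ n<j j≤n))
mainTheorem5 n j _ j≤3n/2 L L-enumerates uniq sorted | no j≰n with m≤n⇒∃[o]m+o≡n (<⇒≤ (≰⇒> j≰n))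
... | d , refl with n+d≤3n/2⇒d+d≤n n d j≤3n/2
...   | d+d≤n
  with sorted-enumeration-subtype2 L L-enumerates uniq sorted (admissible-n≤j d+d≤n) (m+n≤o⇒m≤o∸n d d+d≤n)
...     | alternating , first , final =
  alternating ,
  (λ j≤n → ⊥-elim (j≰n j≤n)) ,
  (λ _ → (λ e → trans first (cong just (%2-+-same⇒parityType≡t12 n d e))) ,
         (λ e → trans first (cong just (%2-+-differs⇒parityType≡t1∣2 n d e))) ,
         (λ e → trans final (cong just (trans (parityType-∸ d≤n) (%2-≡⇒parityType-≡ (n + d) 0 e)))) ,
         (λ e → trans final (cong just (trans (parityType-∸ d≤n) (%2-≡⇒parityType-≡ (n + d) 1 e)))))
  where
  d≤n : d ≤ n
  d≤n = m+n≤o⇒m≤o d d+d≤n
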